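{- Let $\mathbf{X}\in\mathcal{C}$. There exists $\mathbf{Y}\in\mathcal{C}$ such that every extension of $\mathbf{X}$ embeds into every extension of $\mathbf{Y}$.
   Context: $\mathbf{S}(2)$ is the tournament on the points of the unit circle of $\mathbb{C}$ with rational argument, with arc $x\to y$ iff $0<\arg(y/x)<\pi$; $\mathcal{C}$ is the class of finite tournaments isomorphic to induced subtournaments of $\mathbf{S}(2)$. For a linear order $<$ on a set $A$ and a partition of $A$ into two disjoint sets $P_1,P_2$ (possibly empty), $p(A,<,P_1,P_2)$ is the tournament on $A$ with arc $a\to b$ iff ($a,b$ in the same part and $a<b$) or ($a,b$ in different parts and $b<a$). An extension of a tournament $\mathbf{X}$ is a structure $(X,<,P_1,P_2)$ of this kind on the vertex set of $\mathbf{X}$ with $p(X,<,P_1,P_2)=\mathbf{X}$. An embedding of $(A,<^A,P_1^A,P_2^A)$ into $(B,<^B,P_1^B,P_2^B)$ is an order-preserving injection $f$ with $a\in P_i^A\iff f(a)\in P_i^B$. -}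

module Defs where

open import Data.Nat using (ℕ)
open import Data.Fin using (Fin)
open import Data.Bool using (Bool)
open import Data.Product using (Σ; ∃; _×_; _,_)
open import Data.Sum using (_⊎_)
open import Data.Empty using (⊥)
open import Relation.Nullary using (¬_)
open import Relation.Binary.PropositionalEquality using (_≡_; _≢_)
open import Relation.Binary.Structures using (IsStrictTotalOrder)
open import Function.Definitions using (Injective)
open import Function.Bundles using (_⇔_)
open import Data.Rational using (ℚ; _<_; _≤_; _-_; 0ℚ; 1ℚ; ½; -½; -_)

record Tournament (n : ℕ) : Set₁ where
  field
    _⇒_     : Fin n → Fin n → Set
    irrefl  : ∀ a → ¬ (a ⇒ a)
    total   : ∀ a b → a ≢ b → (a ⇒ b) ⊎ (b ⇒ a)
    asym    : ∀ a b → a ⇒ b → ¬ (b ⇒ a)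
open Tournament public

Arc : ℚ → ℚ → Set
Arc qx qy = ((0ℚ < (qy - qx)) × ((qy - qx) < ½))
          ⊎ (((- 1ℚ) < (qy - qx)) × ((qy - qx) < -½))

-- Finite tournament in C: isomorphic to an induced subtournament of S(2),
-- i.e. realised by pairwise distinct, pairwise non-antipodal points.
InC : ∀ {n} → Tournament n → Set
InC {n} X =
  Σ (Fin n → ℚ) λ f →
      (∀ a → (0ℚ ≤ f a) × (f a < 1ℚ))
    × Injective _≡_ _≡_ f
    × (∀ a b → (f b - f a) ≢ ½ × (f b - f a) ≢ -½)
    × (∀ a b → (_⇒_ X a b ⇔ Arc (f a) (f b)))

-- Extension (X,<,P1,P2) of a tournament X: a strict linear order on the
-- vertex set together with a 2-partition (part a ≡ true : a ∈ P1,
-- part a ≡ false : a ∈ P2) such that p(X,<,P1,P2) = X.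
record Extension {n : ℕ} (X : Tournament n) : Set₁ where
  field
    _≺_    : Fin n → Fin n → Set
    isSTO  : IsStrictTotalOrder _≡_ _≺_
    part   : Fin n → Bool
    gives  : ∀ a b → (_⇒_ X a b ⇔
               ((part a ≡ part b × a ≺ b) ⊎ (part a ≢ part b × b ≺ a)))
open Extension public

Embeds : ∀ {n m} {X : Tournament n} {Y : Tournament m} →
         Extension X → Extension Y → Set
Embeds {n} {m} eX eY =
  Σ (Fin n → Fin m) λ f →
      Injective _≡_ _≡_ f
    × (∀ a b → _≺_ eX a b → _≺_ eY (f a) (f b))
    × (∀ a → part eX a ≡ part eY (f a))

-- Take Y = p({0, …, 2n}, <, evens, odds). Two vertices that are adjacent in an extension and lie
-- in the same part are twins (no third vertex tells them apart), but Y has no twins; so every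
-- extension of Y alternates its parts along its order. An extension of any n-vertex tournament
-- then embeds by sending the vertex of rank r to rank 2r or 2r + 1, whichever has its part.
-- Y lies in C: with M = 2n + 1, put vertex k at turn k / 2M if k is even and (k + M) / 2M if odd.
module Submission where

open import Defs
open import Data.Nat as ℕ using (ℕ; zero; suc; _+_; z≤n; s≤s; z<s)
import Data.Nat.Properties as ℕ
open import Data.Fin using (Fin; toℕ; fromℕ<; punchOut)
open import Data.Fin.Properties
  using (toℕ-injective; toℕ-fromℕ<; toℕ<n; any?; _≟_; punchOut-injective; injective⇒≤)
open import Data.Fin.Subset using (Subset; _∈_; _∉_; _⊆_; ∣_∣)
open import Data.Fin.Subset.Properties using (p⊂q⇒∣p∣<∣q∣; ∣⊤∣≡n; ∈⊤)
open import Data.Vec using (tabulate; lookup)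
open import Data.Vec.Properties using (lookup∘tabulate; []=⇒lookup; lookup⇒[]=)
open import Data.Bool using (Bool; true; false; not; _xor_)
import Data.Bool as Bool
open import Data.Bool.Properties
  using (¬-not; not-¬; xor-assoc; xor-same; xor-identityʳ; not-distribˡ-xor; not-distribʳ-xor)
open import Data.Empty using (⊥-elim)
open import Data.Product using (Σ; ∃; _×_; _,_; proj₁; proj₂)
open import Data.Sum using (_⊎_; inj₁; inj₂; [_,_]′)
open import Relation.Nullary using (¬_; yes; no; does; contradiction)
open import Relation.Nullary.Decidable using (toWitnessFalse; dec-true)
open import Level using (0ℓ)
open import Relation.Binary using (Rel; Irreflexive; tri<; tri≈; tri>)
open import Relation.Binary.PropositionalEquality
open import Relation.Binary.Structures using (IsStrictTotalOrder)
open import Function.Definitions using (Injective)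
open import Function.Bundles using (_⇔_; mk⇔; Equivalence)
open import Function.Properties.Equivalence using () renaming (sym to ⇔-sym; trans to ⇔-trans)
open import Data.Sum.Function.Propositional using (_⊎-⇔_)
open import Data.Product.Function.NonDependent.Propositional using (_×-⇔_)
import Data.Integer as ℤ
import Data.Integer.Properties as ℤ
import Data.Rational as ℚ
open ℚ using (ℚ; _<_; _≤_; _-_; -_; 0ℚ; 1ℚ; ½; -½; 1/_; *<*)
import Data.Rational.Properties as ℚ
open import Data.Rational.Literals using (fromℤ)
import Data.Rational.Unnormalised as ℚᵘ
import Data.Rational.Unnormalised.Properties as ℚᵘ
open import Data.Rational.Solver using (module +-*-Solver)

injective⇒surjective : ∀ {m} (f : Fin m → Fin m) → Injective _≡_ _≡_ f → ∀ k → ∃ λ j → f j ≡ k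
injective⇒surjective {zero} f f-inj ()
injective⇒surjective {suc m} f f-inj k with any? (λ j → f j ≟ k)
... | yes hit = hit
... | no miss = contradiction (injective⇒≤ punched-inj) ℕ.1+n≰n
  where
  punched : Fin (suc m) → Fin m
  punched j = punchOut {i = k} {j = f j} (λ eq → miss (j , sym eq))
  punched-inj : Injective _≡_ _≡_ punched
  punched-inj {x} {y} eq = f-inj (punchOut-injective (λ e → miss (x , sym e)) (λ e → miss (y , sym e)) eq)

strictMono⇒injective : ∀ {A B : Set} {_<₁_ : Rel A 0ℓ} {_<₂_ : Rel B 0ℓ} {f : A → B} →
  IsStrictTotalOrder _≡_ _<₁_ → Irreflexive _≡_ _<₂_ →
  (∀ {a b} → a <₁ b → f a <₂ f b) → Injective _≡_ _≡_ f
strictMono⇒injective sto irrefl mono {a} {b} eq with IsStrictTotalOrder.compare sto a b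
... | tri< a<b _ _ = contradiction (mono a<b) (irrefl eq)
... | tri≈ _ a≡b _ = a≡b
... | tri> _ _ b<a = contradiction (mono b<a) (irrefl (sym eq))

module Ranking {m : ℕ} {_≺_ : Rel (Fin m) 0ℓ} (sto : IsStrictTotalOrder _≡_ _≺_) where
  open IsStrictTotalOrder sto using (compare; _<?_) renaming (trans to ≺-trans; irrefl to ≺-irrefl)

  below : Fin m → Subset m
  below a = tabulate (λ c → does (c <? a))

  ∈-below⇔ : ∀ {a c} → c ∈ below a ⇔ c ≺ a
  ∈-below⇔ {a} {c} = mk⇔ to from
    where
    lookup-below : lookup (below a) c ≡ does (c <? a)
    lookup-below = lookup∘tabulate _ c
    to : c ∈ below a → c ≺ a
    to c∈ with c <? a | trans (sym lookup-below) ([]=⇒lookup c∈)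
    ... | yes c≺a | _ = c≺a
    ... | no _    | ()
    from : c ≺ a → c ∈ below a
    from c≺a = lookup⇒[]= c (below a) (trans lookup-below (dec-true (c <? a) c≺a))

  ∉-below-self : ∀ a → a ∉ below a
  ∉-below-self a a∈ = ≺-irrefl refl (Equivalence.to ∈-below⇔ a∈)

  rank : Fin m → ℕ
  rank a = ∣ below a ∣

  rank-mono : ∀ {a b} → a ≺ b → rank a ℕ.< rank b
  rank-mono {a} {b} a≺b =
    p⊂q⇒∣p∣<∣q∣ (below-⊆ , a , Equivalence.from ∈-below⇔ a≺b , ∉-below-self a)
    where
    below-⊆ : below a ⊆ below b
    below-⊆ c∈ = Equivalence.from ∈-below⇔ (≺-trans (Equivalence.to ∈-below⇔ c∈) a≺b)

  rank<m : ∀ a → rank a ℕ.< m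
  rank<m a =
    subst (rank a ℕ.<_) (∣⊤∣≡n m) (p⊂q⇒∣p∣<∣q∣ ((λ _ → ∈⊤) , a , ∈⊤ , ∉-below-self a))

  rank-injective : Injective _≡_ _≡_ rank
  rank-injective = strictMono⇒injective sto ℕ.<-irrefl rank-mono

  rank-cancel-< : ∀ {a b} → rank a ℕ.< rank b → a ≺ b
  rank-cancel-< {a} {b} r<r with compare a b
  ... | tri< a≺b _ _ = a≺b
  ... | tri≈ _ refl _ = contradiction r<r (ℕ.<-irrefl refl)
  ... | tri> _ _ b≺a = contradiction (rank-mono b≺a) (ℕ.<-asym r<r)

  rankFin : Fin m → Fin m
  rankFin a = fromℕ< (rank<m a)

  toℕ-rankFin : ∀ a → toℕ (rankFin a) ≡ rank a
  toℕ-rankFin a = toℕ-fromℕ< (rank<m a)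

  rankFin-injective : Injective _≡_ _≡_ rankFin
  rankFin-injective {a} {b} eq =
    rank-injective (trans (sym (toℕ-rankFin a)) (trans (cong toℕ eq) (toℕ-rankFin b)))

  rankFin-surjective : ∀ k → ∃ λ a → rankFin a ≡ k
  rankFin-surjective = injective⇒surjective rankFin rankFin-injective

  ofRank : (k : ℕ) → .(k ℕ.< m) → Fin m
  ofRank k k<m = proj₁ (rankFin-surjective (fromℕ< k<m))

  rank-ofRank : ∀ k (k<m : k ℕ.< m) → rank (ofRank k k<m) ≡ k
  rank-ofRank k k<m = begin
    rank (ofRank k k<m)            ≡⟨ toℕ-rankFin _ ⟨
    toℕ (rankFin (ofRank k k<m))   ≡⟨ cong toℕ (proj₂ (rankFin-surjective (fromℕ< k<m))) ⟩
    toℕ (fromℕ< k<m)               ≡⟨ toℕ-fromℕ< k<m ⟩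
    k                              ∎
    where open ≡-Reasoning

  ofRank-mono : ∀ {k l} (k<m : k ℕ.< m) (l<m : l ℕ.< m) → k ℕ.< l → ofRank k k<m ≺ ofRank l l<m
  ofRank-mono k<m l<m k<l =
    rank-cancel-< (subst₂ ℕ._<_ (sym (rank-ofRank _ k<m)) (sym (rank-ofRank _ l<m)) k<l)

  nothing-between-ofRank : ∀ {k} (k<m : k ℕ.< m) (1+k<m : suc k ℕ.< m) c →
    ofRank k k<m ≺ c → ¬ c ≺ ofRank (suc k) 1+k<m
  nothing-between-ofRank k<m 1+k<m c below-c above-c =
    ℕ.<⇒≱ (subst (ℕ._< rank c) (rank-ofRank _ k<m) (rank-mono below-c))
          (ℕ.≤-pred (subst (rank c ℕ.<_) (rank-ofRank _ 1+k<m) (rank-mono above-c)))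

Twins : ∀ {m} → Tournament m → Fin m → Fin m → Set
Twins T a b = ∀ c → c ≢ a → c ≢ b → (_⇒_ T c a ⇔ _⇒_ T c b)

Twins-sym : ∀ {m} {T : Tournament m} {a b} → Twins T a b → Twins T b a
Twins-sym twins c c≢b c≢a = ⇔-sym (twins c c≢a c≢b)

-- Any third vertex lies on the same side of a and b, and is in their common part or in neither.
adjacent-samePart⇒Twins : ∀ {m} {T : Tournament m} (e : Extension T) {a b} →
  _≺_ e a b → (∀ c → _≺_ e a c → ¬ _≺_ e c b) → part e a ≡ part e b → Twins T a b
adjacent-samePart⇒Twins {T = T} e {a} {b} a≺b adjacent a~b c c≢a c≢b =
  ⇔-trans (gives e c a)
    (⇔-trans (samePart ×-⇔ below⇔ ⊎-⇔ otherPart ×-⇔ above⇔) (⇔-sym (gives e c b)))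
  where
  open IsStrictTotalOrder (isSTO e) using (compare) renaming (trans to ≺-trans)
  _<ₑ_ = _≺_ e
  samePart : (part e c ≡ part e a) ⇔ (part e c ≡ part e b)
  samePart = mk⇔ (λ eq → trans eq a~b) (λ eq → trans eq (sym a~b))
  otherPart : (part e c ≢ part e a) ⇔ (part e c ≢ part e b)
  otherPart = mk⇔ (λ ne eq → ne (trans eq (sym a~b))) (λ ne eq → ne (trans eq a~b))
  below⇔ : c <ₑ a ⇔ c <ₑ b
  below⇔ = mk⇔ (λ c≺a → ≺-trans c≺a a≺b) from
    where
    from : c <ₑ b → c <ₑ a
    from c≺b with compare c a
    ... | tri< c≺a _ _ = c≺a
    ... | tri≈ _ c≡a _ = contradiction c≡a c≢a
    ... | tri> _ _ a≺c = contradiction c≺b (adjacent c a≺c)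
  above⇔ : a <ₑ c ⇔ b <ₑ c
  above⇔ = mk⇔ to (λ b≺c → ≺-trans a≺b b≺c)
    where
    to : a <ₑ c → b <ₑ c
    to a≺c with compare b c
    ... | tri< b≺c _ _ = b≺c
    ... | tri≈ _ b≡c _ = contradiction (sym b≡c) c≢b
    ... | tri> _ _ c≺b = contradiction c≺b (adjacent c a≺c)

PArc : Bool → Bool → ℕ → ℕ → Set
PArc p q i j = (p ≡ q × i ℕ.< j) ⊎ (p ≢ q × j ℕ.< i)

PArc-irrefl : ∀ p i → ¬ PArc p p i i
PArc-irrefl p i (inj₁ (_ , i<i)) = ℕ.<-irrefl refl i<i
PArc-irrefl p i (inj₂ (p≢p , _)) = p≢p refl

PArc-asym : ∀ p q i j → PArc p q i j → ¬ PArc q p j i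
PArc-asym p q i j (inj₁ (_ , i<j)) (inj₁ (_ , j<i)) = ℕ.<-asym i<j j<i
PArc-asym p q i j (inj₁ (p≡q , _)) (inj₂ (q≢p , _)) = q≢p (sym p≡q)
PArc-asym p q i j (inj₂ (p≢q , _)) (inj₁ (q≡p , _)) = p≢q (sym q≡p)
PArc-asym p q i j (inj₂ (_ , j<i)) (inj₂ (_ , i<j)) = ℕ.<-asym i<j j<i

PArc-total : ∀ p q {i j} → i ≢ j → PArc p q i j ⊎ PArc q p j i
PArc-total p q {i} {j} i≢j with p Bool.≟ q | ℕ.<-cmp i j
... | _       | tri≈ _ i≡j _ = contradiction i≡j i≢j
... | yes p≡q | tri< i<j _ _ = inj₁ (inj₁ (p≡q , i<j))
... | yes p≡q | tri> _ _ j<i = inj₂ (inj₁ (sym p≡q , j<i))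
... | no p≢q  | tri< i<j _ _ = inj₂ (inj₂ ((λ q≡p → p≢q (sym q≡p)) , i<j))
... | no p≢q  | tri> _ _ j<i = inj₁ (inj₂ (p≢q , j<i))

PArc-same : ∀ {p i j} → PArc p p i j ⇔ i ℕ.< j
PArc-same = mk⇔ (λ { (inj₁ (_ , i<j)) → i<j ; (inj₂ (p≢p , _)) → contradiction refl p≢p })
                (λ i<j → inj₁ (refl , i<j))

PArc-different : ∀ {p q i j} → p ≢ q → PArc p q i j ⇔ j ℕ.< i
PArc-different p≢q = mk⇔ (λ { (inj₁ (p≡q , _)) → contradiction p≡q p≢q ; (inj₂ (_ , j<i)) → j<i })
                         (λ j<i → inj₂ (p≢q , j<i))

odd : ℕ → Bool
odd zero    = false
odd (suc k) = not (odd k)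

odd-+ : ∀ i j → odd (i + j) ≡ odd i xor odd j
odd-+ zero    j = refl
odd-+ (suc i) j = trans (cong not (odd-+ i j)) (not-distribˡ-xor (odd i) (odd j))

odd-double : ∀ k → odd (k + k) ≡ false
odd-double k = trans (odd-+ k k) (xor-same (odd k))

odd-suc≢ : ∀ k → odd (suc k) ≢ odd k
odd-suc≢ k eq = not-¬ refl (sym eq)

ParityArc : ℕ → ℕ → Set
ParityArc i j = PArc (odd i) (odd j) i j

ParityTournament : (M : ℕ) → Tournament M
ParityTournament M = record
  { _⇒_    = λ a b → ParityArc (toℕ a) (toℕ b)
  ; irrefl = λ a → PArc-irrefl _ (toℕ a)
  ; total  = λ a b a≢b → PArc-total _ _ (λ eq → a≢b (toℕ-injective eq))
  ; asym   = λ a b → PArc-asym _ _ (toℕ a) (toℕ b)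
  }

Separates : ℕ → ℕ → ℕ → Set
Separates c i j = c ≢ i × c ≢ j × ¬ (ParityArc c i ⇔ ParityArc c j)

successor-separates : ∀ {i j} → i ℕ.< j → odd i ≡ odd j → Separates (suc i) i j
successor-separates {i} {j} i<j i~j =
  (λ eq → ℕ.<-irrefl (sym eq) (ℕ.n<1+n i)) , (λ eq → ℕ.<-irrefl eq 1+i<j) ,
  λ iff → ¬arc-j (Equivalence.to iff arc-i)
  where
  1+i<j : suc i ℕ.< j
  1+i<j with ℕ.m≤n⇒m<n∨m≡n i<j
  ... | inj₁ 1+i<j = 1+i<j
  ... | inj₂ 1+i≡j = contradiction (trans (cong odd 1+i≡j) (sym i~j)) (odd-suc≢ i)
  arc-i : ParityArc (suc i) i
  arc-i = inj₂ (odd-suc≢ i , ℕ.n<1+n i)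
  ¬arc-j : ¬ ParityArc (suc i) j
  ¬arc-j (inj₁ (eq , _))  = odd-suc≢ i (trans eq (sym i~j))
  ¬arc-j (inj₂ (_ , j<1+i)) = ℕ.<-asym j<1+i 1+i<j

zero-separates : ∀ {i j} → 0 ℕ.< i → 0 ℕ.< j → odd i ≢ odd j → Separates 0 i j
zero-separates {i} {j} 0<i 0<j i≁j =
  (λ eq → ℕ.<-irrefl eq 0<i) , (λ eq → ℕ.<-irrefl eq 0<j) ,
  λ iff → differ i≁j (⇔-trans (⇔-sym (arc-from-zero 0<i)) (⇔-trans iff (arc-from-zero 0<j)))
  where
  arc-from-zero : ∀ {k} → 0 ℕ.< k → ParityArc 0 k ⇔ (false ≡ odd k)
  arc-from-zero 0<k = mk⇔ (λ { (inj₁ (eq , _)) → eq ; (inj₂ (_ , ())) }) (λ eq → inj₁ (eq , 0<k))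
  differ : ∀ {x y} → x ≢ y → ¬ ((false ≡ x) ⇔ (false ≡ y))
  differ {false} {false} x≢y _   = x≢y refl
  differ {false} {true}  _   iff = contradiction (Equivalence.to iff refl) (λ ())
  differ {true}  {false} _   iff = contradiction (Equivalence.from iff refl) (λ ())
  differ {true}  {true}  x≢y _   = x≢y refl

last-separates : ∀ n {j} → 0 ℕ.< j → j ℕ.≤ n + n → odd 0 ≢ odd j → Separates (n + n) 0 j
last-separates n {j} 0<j j≤2n 0≁j =
  (λ eq → ℕ.<-irrefl (sym eq) (ℕ.<-≤-trans 0<j j≤2n)) , (λ eq → 2n≁j (cong odd eq)) ,
  λ iff → ¬arc-0 (Equivalence.from iff arc-j)
  where
  2n≁j : odd (n + n) ≢ odd j
  2n≁j eq = 0≁j (trans (sym (odd-double n)) eq)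
  j<2n : j ℕ.< n + n
  j<2n with ℕ.m≤n⇒m<n∨m≡n j≤2n
  ... | inj₁ j<2n = j<2n
  ... | inj₂ j≡2n = contradiction (cong odd (sym j≡2n)) 2n≁j
  arc-j : ParityArc (n + n) j
  arc-j = inj₂ (2n≁j , j<2n)
  ¬arc-0 : ¬ ParityArc (n + n) 0
  ¬arc-0 (inj₁ (_ , ()))
  ¬arc-0 (inj₂ (2n≁0 , _)) = 2n≁0 (odd-double n)

-- Needs the odd size: the last vertex n + n is even.
parity-separates : ∀ n {i j} → i ℕ.< j → j ℕ.≤ n + n → ∃ λ c → c ℕ.≤ n + n × Separates c i j
parity-separates n {i} {j} i<j j≤2n with odd i Bool.≟ odd j
... | yes i~j = suc i , ℕ.≤-trans i<j j≤2n , successor-separates i<j i~j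
parity-separates n {zero}  i<j j≤2n | no i≁j = n + n , ℕ.≤-refl , last-separates n i<j j≤2n i≁j
parity-separates n {suc _} i<j j≤2n | no i≁j = 0 , z≤n , zero-separates z<s (ℕ.<-trans z<s i<j) i≁j

parity-twinFree-< : ∀ n {a b : Fin (suc (n + n))} → toℕ a ℕ.< toℕ b →
  ¬ Twins (ParityTournament (suc (n + n))) a b
parity-twinFree-< n {a} {b} a<b twins with parity-separates n a<b (ℕ.≤-pred (toℕ<n b))
... | c , c≤2n , c≢a , c≢b , ¬iff =
  ¬iff (subst (λ x → ParityArc x (toℕ a) ⇔ ParityArc x (toℕ b)) (toℕ-fromℕ< c<M)
              (twins (fromℕ< c<M) (avoids c≢a) (avoids c≢b)))
  where
  c<M : c ℕ.< suc (n + n)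
  c<M = s≤s c≤2n
  avoids : ∀ {d} → c ≢ toℕ d → fromℕ< c<M ≢ d
  avoids c≢d eq = c≢d (trans (sym (toℕ-fromℕ< c<M)) (cong toℕ eq))

parity-twinFree : ∀ n {a b : Fin (suc (n + n))} → a ≢ b → ¬ Twins (ParityTournament (suc (n + n))) a b
parity-twinFree n {a} {b} a≢b twins with ℕ.<-cmp (toℕ a) (toℕ b)
... | tri< a<b _ _ = parity-twinFree-< n a<b twins
... | tri≈ _ a≡b _ = a≢b (toℕ-injective a≡b)
... | tri> _ _ b<a = parity-twinFree-< n b<a (Twins-sym {T = ParityTournament (suc (n + n))} twins)

module AlternatingExtension (n : ℕ) (eY : Extension (ParityTournament (suc (n + n)))) where
  open Ranking (isSTO eY) public

  parts-alternate : ∀ {k} (k<M : k ℕ.< suc (n + n)) (1+k<M : suc k ℕ.< suc (n + n)) →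
    part eY (ofRank k k<M) ≢ part eY (ofRank (suc k) 1+k<M)
  parts-alternate {k} k<M 1+k<M same = parity-twinFree n distinct
    (adjacent-samePart⇒Twins eY (ofRank-mono k<M 1+k<M (ℕ.n<1+n k)) (nothing-between-ofRank k<M 1+k<M) same)
    where
    distinct : ofRank k k<M ≢ ofRank (suc k) 1+k<M
    distinct eq =
      ℕ.1+n≢n (trans (sym (rank-ofRank (suc k) 1+k<M)) (trans (cong rank (sym eq)) (rank-ofRank k k<M)))

  β : Bool
  β = part eY (ofRank 0 z<s)

  part-ofRank : ∀ k (k<M : k ℕ.< suc (n + n)) → part eY (ofRank k k<M) ≡ β xor odd k
  part-ofRank zero    _     = sym (xor-identityʳ β)
  part-ofRank (suc k) 1+k<M = begin
    part eY (ofRank (suc k) 1+k<M)  ≡⟨ ¬-not (λ eq → parts-alternate k<M 1+k<M (sym eq)) ⟩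
    not (part eY (ofRank k k<M))    ≡⟨ cong not (part-ofRank k k<M) ⟩
    not (β xor odd k)               ≡⟨ not-distribʳ-xor β (odd k) ⟩
    β xor odd (suc k)               ∎
    where
    open ≡-Reasoning
    k<M : k ℕ.< suc (n + n)
    k<M = ℕ.<-trans (ℕ.n<1+n k) 1+k<M

slot : ℕ → Bool → ℕ
slot r false = r + r
slot r true  = suc (r + r)

odd-slot : ∀ r b → odd (slot r b) ≡ b
odd-slot r false = odd-double r
odd-slot r true  = cong not (odd-double r)

slot≤ : ∀ r b → slot r b ℕ.≤ suc (r + r)
slot≤ r false = ℕ.n≤1+n (r + r)
slot≤ r true  = ℕ.≤-refl

2+double≤double : ∀ {r s} → r ℕ.< s → suc (suc (r + r)) ℕ.≤ s + s
2+double≤double {r} {s} r<s = subst (ℕ._≤ s + s) (cong suc (ℕ.+-suc r r)) (ℕ.+-mono-≤ r<s r<s)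

slot-mono : ∀ {r s} b c → r ℕ.< s → slot r b ℕ.< slot s c
slot-mono {r} {s} b c r<s = begin-strict
  slot r b        ≤⟨ slot≤ r b ⟩
  suc (r + r)     <⟨ ℕ.n<1+n _ ⟩
  suc (suc (r + r)) ≤⟨ 2+double≤double r<s ⟩
  s + s           ≤⟨ slot≥ s c ⟩
  slot s c        ∎
  where
  open ℕ.≤-Reasoning
  slot≥ : ∀ s c → s + s ℕ.≤ slot s c
  slot≥ s false = ℕ.≤-refl
  slot≥ s true  = ℕ.n≤1+n (s + s)

slot<1+double : ∀ {r n} b → r ℕ.< n → slot r b ℕ.< suc (n + n)
slot<1+double {r} b r<n =
  s≤s (ℕ.≤-trans (ℕ.n≤1+n _) (ℕ.≤-trans (s≤s (slot≤ r b)) (2+double≤double r<n)))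

embedding : ∀ n {X : Tournament n} (eX : Extension X) (eY : Extension (ParityTournament (suc (n + n)))) →
  Embeds eX eY
embedding n eX eY = f , strictMono⇒injective (isSTO eX) ≺Y-irrefl f-mono , (λ a b → f-mono) , part-f
  where
  open AlternatingExtension n eY using (ofRank; ofRank-mono; β; part-ofRank)
  open IsStrictTotalOrder (isSTO eY) using () renaming (irrefl to ≺Y-irrefl)
  module X = Ranking (isSTO eX)
  shift : Fin n → Bool
  shift a = β xor part eX a
  index : Fin n → ℕ
  index a = slot (X.rank a) (shift a)
  index<M : ∀ a → index a ℕ.< suc (n + n)
  index<M a = slot<1+double (shift a) (X.rank<m a)
  f : Fin n → Fin (suc (n + n))
  f a = ofRank (index a) (index<M a)
  f-mono : ∀ {a b} → _≺_ eX a b → _≺_ eY (f a) (f b)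
  f-mono {a} {b} a≺b = ofRank-mono (index<M a) (index<M b) (slot-mono (shift a) (shift b) (X.rank-mono a≺b))
  part-f : ∀ a → part eX a ≡ part eY (f a)
  part-f a = sym (begin
    part eY (f a)                              ≡⟨ part-ofRank (index a) (index<M a) ⟩
    β xor odd (slot (X.rank a) (shift a))      ≡⟨ cong (β xor_) (odd-slot (X.rank a) (shift a)) ⟩
    β xor (β xor part eX a)                    ≡⟨ xor-assoc β β (part eX a) ⟨
    (β xor β) xor part eX a                    ≡⟨ cong (_xor part eX a) (xor-same β) ⟩
    part eX a                                  ∎)
    where open ≡-Reasoning

<-shift : ∀ {p q p′ q′} r → p ℚ.+ r ≡ p′ → q ℚ.+ r ≡ q′ → p < q ⇔ p′ < q′
<-shift {p} {q} r refl refl = mk⇔ (ℚ.+-monoˡ-< r) cancel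
  where
  open +-*-Solver
  cancel : p ℚ.+ r < q ℚ.+ r → p < q
  cancel lt = subst₂ _<_ (unshift p) (unshift q) (ℚ.+-monoˡ-< (- r) lt)
    where
    unshift : ∀ x → x ℚ.+ r ℚ.+ - r ≡ x
    unshift x = solve 2 (λ x r → x :+ r :+ :- r := x) refl x r

module _ (x y : ℚ) {c z : ℚ} where
  open +-*-Solver

  <-diff⇔ : c ℚ.+ x ≡ z → (c < y - x) ⇔ (z < y)
  <-diff⇔ eq = <-shift x eq (solve 2 (λ x y → (y :- x) :+ x := y) refl x y)

  diff-<⇔ : c ℚ.+ x ≡ z → (y - x < c) ⇔ (y < z)
  diff-<⇔ eq = <-shift x (solve 2 (λ x y → (y :- x) :+ x := y) refl x y) eq

  -<-diff⇔ : y ℚ.+ c ≡ z → (- c < y - x) ⇔ (x < z)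
  -<-diff⇔ eq = <-shift (x ℚ.+ c) (solve 2 (λ x c → :- c :+ (x :+ c) := x) refl x c)
    (trans (solve 3 (λ x y c → (y :- x) :+ (x :+ c) := y :+ c) refl x y c) eq)

  diff-<-⇔ : y ℚ.+ c ≡ z → (y - x < - c) ⇔ (z < x)
  diff-<-⇔ eq = <-shift (x ℚ.+ c) (trans (solve 3 (λ x y c → (y :- x) :+ (x :+ c) := y :+ c) refl x y c) eq)
    (solve 2 (λ x c → :- c :+ (x :+ c) := x) refl x c)

x-y≡-[y-x] : ∀ x y → x - y ≡ - (y - x)
x-y≡-[y-x] = solve 2 (λ x y → x :- y := :- (y :- x)) refl
  where open +-*-Solver

Arc-irrefl : ∀ q → ¬ Arc q q
Arc-irrefl q arc with q - q | ℚ.+-inverseʳ q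
Arc-irrefl q (inj₁ (0<0 , _))  | _ | refl = ℚ.<-irrefl refl 0<0
Arc-irrefl q (inj₂ (_ , 0<-½)) | _ | refl = toWitnessFalse {a? = 0ℚ ℚ.<? -½} _ 0<-½

Arc-antipodal : ∀ {x y} → y - x ≡ ½ → ¬ Arc x y × ¬ Arc y x
Arc-antipodal {x} {y} y-x≡½ = forward , backward
  where
  x-y≡-½ : x - y ≡ -½
  x-y≡-½ = trans (x-y≡-[y-x] x y) (cong -_ y-x≡½)
  forward : ¬ Arc x y
  forward (inj₁ (_ , ½<½))  = ℚ.<-irrefl refl (subst (_< ½) y-x≡½ ½<½)
  forward (inj₂ (_ , ½<-½)) = toWitnessFalse {a? = ½ ℚ.<? -½} _ (subst (_< -½) y-x≡½ ½<-½)
  backward : ¬ Arc y x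
  backward (inj₁ (0<-½ , _))  = toWitnessFalse {a? = 0ℚ ℚ.<? -½} _ (subst (0ℚ <_) x-y≡-½ 0<-½)
  backward (inj₂ (_ , -½<-½)) = ℚ.<-irrefl refl (subst (_< -½) x-y≡-½ -½<-½)

-- Distinctness and non-antipodality come for free: X joins distinct vertices, while Arc is
-- irreflexive and never joins points half a turn apart.
arcPreserving⇒InC : ∀ {n} (X : Tournament n) (f : Fin n → ℚ) →
  (∀ a → (0ℚ ≤ f a) × (f a < 1ℚ)) → (∀ a b → _⇒_ X a b ⇔ Arc (f a) (f b)) → InC X
arcPreserving⇒InC X f bounds arcs = f , bounds , f-injective , (λ a b → not-½ a b , not-½′ a b) , arcs
  where
  some-arc : ∀ {a b} → a ≢ b → Arc (f a) (f b) ⊎ Arc (f b) (f a)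
  some-arc {a} {b} a≢b with total X a b a≢b
  ... | inj₁ a⇒b = inj₁ (Equivalence.to (arcs a b) a⇒b)
  ... | inj₂ b⇒a = inj₂ (Equivalence.to (arcs b a) b⇒a)
  f-injective : Injective _≡_ _≡_ f
  f-injective {a} {b} fa≡fb with a ≟ b
  ... | yes a≡b = a≡b
  ... | no a≢b with some-arc a≢b
  ...   | inj₁ arc = ⊥-elim (Arc-irrefl (f b) (subst (λ q → Arc q (f b)) fa≡fb arc))
  ...   | inj₂ arc = ⊥-elim (Arc-irrefl (f b) (subst (Arc (f b)) fa≡fb arc))
  not-½ : ∀ a b → f b - f a ≢ ½
  not-½ a b fb-fa≡½ with a ≟ b
  ... | yes refl = 0≢½ (trans (sym (ℚ.+-inverseʳ (f a))) fb-fa≡½)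
    where
    0≢½ : 0ℚ ≢ ½
    0≢½ ()
  ... | no a≢b = [ proj₁ antipodal , proj₂ antipodal ]′ (some-arc a≢b)
    where
    antipodal : ¬ Arc (f a) (f b) × ¬ Arc (f b) (f a)
    antipodal = Arc-antipodal {f a} {f b} fb-fa≡½
  not-½′ : ∀ a b → f b - f a ≢ -½
  not-½′ a b fb-fa≡-½ = not-½ b a (trans (x-y≡-[y-x] (f a) (f b)) (cong -_ fb-fa≡-½))

ι : ℕ → ℚ
ι k = fromℤ (ℤ.+ k)

ι-<⇔ : ∀ {j k} → ι j < ι k ⇔ j ℕ.< k
ι-<⇔ {j} {k} = mk⇔ to from
  where
  to : ι j < ι k → j ℕ.< k
  to lt with subst₂ ℤ._<_ (ℤ.*-identityʳ (ℤ.+ j)) (ℤ.*-identityʳ (ℤ.+ k)) (ℚ.drop-*<* lt)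
  ... | ℤ.+<+ j<k = j<k
  from : j ℕ.< k → ι j < ι k
  from j<k = *<* (subst₂ ℤ._<_ (sym (ℤ.*-identityʳ (ℤ.+ j))) (sym (ℤ.*-identityʳ (ℤ.+ k))) (ℤ.+<+ j<k))

ι-+ : ∀ j k → ι (j + k) ≡ ι j ℚ.+ ι k
ι-+ j k =
  ℚ.toℚᵘ-injective (ℚᵘ.≃-sym (ℚᵘ.≃-trans (ℚ.toℚᵘ-homo-+ (ι j) (ι k)) (ℚᵘ.*≡* cross)))
  where
  cross : (ℤ.+ j ℤ.* ℤ.+ 1 ℤ.+ ℤ.+ k ℤ.* ℤ.+ 1) ℤ.* ℤ.+ 1 ≡ ℤ.+ (j + k) ℤ.* ℤ.+ 1
  cross = trans (ℤ.*-identityʳ _)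
    (trans (cong₂ ℤ._+_ (ℤ.*-identityʳ (ℤ.+ j)) (ℤ.*-identityʳ (ℤ.+ k))) (sym (ℤ.*-identityʳ _)))

x+x≡1⇒x≡½ : ∀ {x} → x ℚ.+ x ≡ 1ℚ → x ≡ ½
x+x≡1⇒x≡½ {x} x+x≡1 with ℚ.<-cmp x ½
... | tri< x<½ _ _ = contradiction (subst (_< 1ℚ) x+x≡1 (ℚ.+-mono-< x<½ x<½)) (ℚ.<-irrefl refl)
... | tri≈ _ x≡½ _ = x≡½
... | tri> _ _ ½<x = contradiction (subst (1ℚ <_) x+x≡1 (ℚ.+-mono-< ½<x ½<x)) (ℚ.<-irrefl refl)

module ParityRealisation (m : ℕ) where
  M D : ℕ
  M = suc m
  D = M + M

  h : ℕ → ℚ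
  h k = ι k ℚ.* 1/ ι D

  instance
    1/D-positive : ℚ.Positive (1/ ι D)
    1/D-positive = ℚ.1/pos⇒pos (ι D)

  h-+ : ∀ j k → h (j + k) ≡ h j ℚ.+ h k
  h-+ j k = trans (cong (ℚ._* 1/ ι D) (ι-+ j k)) (ℚ.*-distribʳ-+ (1/ ι D) (ι j) (ι k))

  h-<⇔ : ∀ j k → h j < h k ⇔ j ℕ.< k
  h-<⇔ _ _ = mk⇔ (λ lt → Equivalence.to ι-<⇔ (ℚ.*-cancelʳ-<-nonNeg (1/ ι D) lt))
                 (λ lt → ℚ.*-monoˡ-<-pos (1/ ι D) (Equivalence.from ι-<⇔ lt))

  h-0 : h 0 ≡ 0ℚ
  h-0 = ℚ.*-zeroˡ (1/ ι D)

  h-D : h D ≡ 1ℚ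
  h-D = ℚ.*-inverseʳ (ι D)

  h-M : h M ≡ ½
  h-M = x+x≡1⇒x≡½ (trans (sym (h-+ M M)) h-D)

  h-nonNeg : ∀ k → 0ℚ ≤ h k
  h-nonNeg zero    = ℚ.≤-reflexive (sym h-0)
  h-nonNeg (suc k) = ℚ.<⇒≤ (subst (_< h (suc k)) h-0 (Equivalence.from (h-<⇔ 0 (suc k)) z<s))

  -- Arc measured in steps of 1/D turn.
  DiscreteArc : ℕ → ℕ → Set
  DiscreteArc j k = (j ℕ.< k × k ℕ.< M + j) ⊎ (j ℕ.< k + D × k + M ℕ.< j)

  Arc-h : ∀ j k → Arc (h j) (h k) ⇔ DiscreteArc j k
  Arc-h j k =
    (⇔-trans (<-diff⇔ (h j) (h k) (ℚ.+-identityˡ (h j))) (h-<⇔ j k) ×-⇔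
     ⇔-trans (diff-<⇔ (h j) (h k) ½+h-j) (h-<⇔ k (M + j))) ⊎-⇔
    (⇔-trans (-<-diff⇔ (h j) (h k) h-k+1) (h-<⇔ j (k + D)) ×-⇔
     ⇔-trans (diff-<-⇔ (h j) (h k) h-k+½) (h-<⇔ (k + M) j))
    where
    ½+h-j : ½ ℚ.+ h j ≡ h (M + j)
    ½+h-j = trans (cong (ℚ._+ h j) (sym h-M)) (sym (h-+ M j))
    h-k+1 : h k ℚ.+ 1ℚ ≡ h (k + D)
    h-k+1 = trans (cong (h k ℚ.+_) (sym h-D)) (sym (h-+ k D))
    h-k+½ : h k ℚ.+ ½ ≡ h (k + M)
    h-k+½ = trans (cong (h k ℚ.+_) (sym h-M)) (sym (h-+ k M))

  DiscreteArc-same : ∀ o {i j} → i ℕ.< M → j ℕ.< M → DiscreteArc (o + i) (o + j) ⇔ i ℕ.< j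
  DiscreteArc-same o {i} {j} i<M j<M = mk⇔ to from
    where
    open ℕ.≤-Reasoning
    to : DiscreteArc (o + i) (o + j) → i ℕ.< j
    to (inj₁ (o+i<o+j , _)) = ℕ.+-cancelˡ-< o i j o+i<o+j
    to (inj₂ (_ , o+j+M<o+i)) = contradiction o+j+M<o+i (ℕ.<-asym (begin-strict
      o + i      <⟨ ℕ.+-monoʳ-< o i<M ⟩
      o + M      ≤⟨ ℕ.+-monoˡ-≤ M (ℕ.m≤m+n o j) ⟩
      o + j + M  ∎))
    from : i ℕ.< j → DiscreteArc (o + i) (o + j)
    from i<j = inj₁ (ℕ.+-monoʳ-< o i<j , (begin-strict
      o + j       <⟨ ℕ.+-monoʳ-< o j<M ⟩
      o + M       ≡⟨ ℕ.+-comm o M ⟩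
      M + o       ≤⟨ ℕ.+-monoʳ-≤ M (ℕ.m≤m+n o i) ⟩
      M + (o + i) ∎))

  DiscreteArc-up : ∀ {i j} → i ℕ.< M → j ℕ.< M → DiscreteArc i (M + j) ⇔ j ℕ.< i
  DiscreteArc-up {i} {j} i<M j<M = mk⇔ to from
    where
    i<M+j : i ℕ.< M + j
    i<M+j = ℕ.<-≤-trans i<M (ℕ.m≤m+n M j)
    to : DiscreteArc i (M + j) → j ℕ.< i
    to (inj₁ (_ , M+j<M+i)) = ℕ.+-cancelˡ-< M j i M+j<M+i
    to (inj₂ (_ , M+j+M<i)) = contradiction M+j+M<i (ℕ.<-asym (ℕ.<-≤-trans i<M+j (ℕ.m≤m+n (M + j) M)))
    from : j ℕ.< i → DiscreteArc i (M + j)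
    from j<i = inj₁ (i<M+j , ℕ.+-monoʳ-< M j<i)

  DiscreteArc-down : ∀ {i j} → i ℕ.< M → j ℕ.< M → DiscreteArc (M + i) j ⇔ j ℕ.< i
  DiscreteArc-down {i} {j} i<M j<M = mk⇔ to from
    where
    j+M<M+i⇔j<i : j + M ℕ.< M + i ⇔ j ℕ.< i
    j+M<M+i⇔j<i = mk⇔ (λ lt → ℕ.+-cancelˡ-< M j i (subst (ℕ._< M + i) (ℕ.+-comm j M) lt))
                      (λ lt → subst (ℕ._< M + i) (ℕ.+-comm M j) (ℕ.+-monoʳ-< M lt))
    to : DiscreteArc (M + i) j → j ℕ.< i
    to (inj₁ (M+i<j , _)) = contradiction M+i<j (ℕ.<-asym (ℕ.<-≤-trans j<M (ℕ.m≤m+n M i)))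
    to (inj₂ (_ , j+M<M+i)) = Equivalence.to j+M<M+i⇔j<i j+M<M+i
    from : j ℕ.< i → DiscreteArc (M + i) j
    from j<i =
      inj₂ (ℕ.<-≤-trans (ℕ.+-monoʳ-< M i<M) (ℕ.m≤n+m D j) , Equivalence.from j+M<M+i⇔j<i j<i)

  offset : Bool → ℕ
  offset false = 0
  offset true  = M

  place : Bool → ℕ → ℕ
  place p k = offset p + k

  place<D : ∀ p {k} → k ℕ.< M → place p k ℕ.< D
  place<D false k<M = ℕ.<-≤-trans k<M (ℕ.m≤m+n M M)
  place<D true  k<M = ℕ.+-monoʳ-< M k<M

  place-arc : ∀ p q {i j} → i ℕ.< M → j ℕ.< M → DiscreteArc (place p i) (place q j) ⇔ PArc p q i j
  place-arc false false i<M j<M = ⇔-trans (DiscreteArc-same 0 i<M j<M) (⇔-sym PArc-same)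
  place-arc true  true  i<M j<M = ⇔-trans (DiscreteArc-same M i<M j<M) (⇔-sym PArc-same)
  place-arc false true  i<M j<M = ⇔-trans (DiscreteArc-up i<M j<M) (⇔-sym (PArc-different λ ()))
  place-arc true  false i<M j<M = ⇔-trans (DiscreteArc-down i<M j<M) (⇔-sym (PArc-different λ ()))

  position : Fin M → ℕ
  position a = place (odd (toℕ a)) (toℕ a)

  point : Fin M → ℚ
  point a = h (position a)

  parityTournament∈C : InC (ParityTournament M)
  parityTournament∈C = arcPreserving⇒InC (ParityTournament M) point bounds arcs
    where
    bounds : ∀ a → (0ℚ ≤ point a) × (point a < 1ℚ)
    bounds a = h-nonNeg (position a) ,
      subst (point a <_) h-D (Equivalence.from (h-<⇔ (position a) D) (place<D _ (toℕ<n a)))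
    arcs : ∀ a b → ParityArc (toℕ a) (toℕ b) ⇔ Arc (point a) (point b)
    arcs a b = ⇔-sym (⇔-trans (Arc-h (position a) (position b)) (place-arc _ _ (toℕ<n a) (toℕ<n b)))

lemma3p2 : ∀ (n : ℕ) (X : Tournament n) → InC X →
    Σ ℕ λ m → Σ (Tournament m) λ Y → InC Y ×
    (∀ (eX : Extension X) (eY : Extension Y) → Embeds eX eY)
lemma3p2 n X _ = suc (n + n) , ParityTournament (suc (n + n)) ,
  ParityRealisation.parityTournament∈C (n + n) , embedding n
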